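{- A simple permutation has at most $48$ pin words, and all of them are strict or quasi-strict.
   Context: A permutation of size $n$ is simple if $n\ge4$ and its only blocks (sets of consecutive positions whose images form an interval) are singletons and $\{1,\dots,n\}$. A pin representation of a permutation is a sequence of points $(p_1,\dots,p_n)$, no two on a common horizontal or vertical line, order-isomorphic to its diagram $\{(i,\pi_i)\}$, such that each $p_i$ ($i\ge2$) lies outside the bounding box (smallest axis-parallel rectangle) of $\{p_1,\dots,p_{i-1}\}$ and either separates $p_{i-1}$ from $\{p_1,\dots,p_{i-2}\}$ (the horizontal or vertical line through $p_i$ has them on opposite sides) or does not separate $\{p_1,\dots,p_{i-1}\}$ into two nonempty sets. Pin words: given a pin representation and an origin point $p_0$ such that $(p_0,p_1,\dots,p_n)$ satisfies the same conditions, each $p_i$ ($i\ge1$) is encoded by $U$ (resp. $D,L,R$) if $p_i$ separates $p_{i-1}$ from $\{p_0,\dots,p_{i-2}\}$ from the top (resp. bottom, left, right), and by $1$ (resp. $2,3,4$) if $p_i$ does not separate $\{p_0,\dots,p_{i-1}\}$ into two nonempty sets and lies up-right (resp. up-left, bottom-left, bottom-right) of the bounding box of $\{p_0,\dots,p_{i-1}\}$; the pin words of a permutation are all words so obtained from all its pin representations and admissible origins. A strict (resp. quasi-strict) pin word consists of one numeral (resp. two numerals) among $1,2,3,4$ followed only by letters of $\{U,D,L,R\}$. -}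

module Defs where

open import Data.Nat using (ℕ; zero; suc; _≤_; _<_; _∸_)
open import Data.Fin using (Fin; toℕ)
open import Data.Fin.Permutation using (Permutation′; _⟨$⟩ʳ_)
open import Data.Product using (Σ; ∃; _×_; _,_; proj₁; proj₂)
open import Data.Sum using (_⊎_)
open import Data.List using (List; []; _∷_; length)
open import Data.Unit using (⊤)
open import Data.List.Relation.Unary.All using (All)
open import Relation.Binary.PropositionalEquality using (_≡_; _≢_)
open import Relation.Nullary using (¬_)
open import Function.Bundles using (_⇔_)

-- A permutation of size n is π : Permutation′ n (a bijection Fin n → Fin n);
-- position k (0-based) has image π ⟨$⟩ʳ k.  Its diagram is {(k , π k)}.

val : ∀ {n} → Permutation′ n → Fin n → ℕ
val π k = toℕ (π ⟨$⟩ʳ k)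

IsInterval : (ℕ → Set) → Set
IsInterval S = ∀ a b c → S a → S c → a ≤ b → b ≤ c → S b

ImageOf : ∀ {n} → Permutation′ n → Fin n → Fin n → ℕ → Set
ImageOf π i j v = ∃ λ k → (toℕ i ≤ toℕ k) × (toℕ k ≤ toℕ j) × (val π k ≡ v)

IsBlock : ∀ {n} → Permutation′ n → Fin n → Fin n → Set
IsBlock π i j = (toℕ i ≤ toℕ j) × IsInterval (ImageOf π i j)

Simple : ∀ {n} → Permutation′ n → Set
Simple {n} π = (4 ≤ n) ×
  (∀ i j → IsBlock π i j → (toℕ i ≡ toℕ j) ⊎ ((toℕ i ≡ 0) × (suc (toℕ j) ≡ n)))

-- Only the relative order of coordinates matters for every notion
-- below, so points with natural-number coordinates suffice (any finite
-- configuration of points in the plane is order-isomorphic to one in ℕ²).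

Point : Set
Point = ℕ × ℕ

X Y : Point → ℕ
X = proj₁
Y = proj₂

-- A finite sequence of points of length m is a function P : ℕ → Point of which
-- only P 0, …, P (m - 1) matter.  Sets of points of the sequence are given as
-- predicates on indices.

Seq : Set
Seq = ℕ → Point

GeneralPosition : Seq → ℕ → Set
GeneralPosition P m = ∀ j k → j < m → k < m → j ≢ k →
  (X (P j) ≢ X (P k)) × (Y (P j) ≢ Y (P k))

InBox : Seq → ℕ → Point → Set
InBox P i c =
  (∃ λ j → j < i × X (P j) ≤ X c) × (∃ λ j → j < i × X c ≤ X (P j)) ×
  (∃ λ j → j < i × Y (P j) ≤ Y c) × (∃ λ j → j < i × Y c ≤ Y (P j))

Separates : Seq → Point → (ℕ → Set) → (ℕ → Set) → Set
Separates P c A B =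
  ((∀ a → A a → Y (P a) < Y c) × (∀ b → B b → Y c < Y (P b))) ⊎
  ((∀ a → A a → Y c < Y (P a)) × (∀ b → B b → Y (P b) < Y c)) ⊎
  ((∀ a → A a → X (P a) < X c) × (∀ b → B b → X c < X (P b))) ⊎
  ((∀ a → A a → X c < X (P a)) × (∀ b → B b → X (P b) < X c))

NoSplit : Seq → Point → (ℕ → Set) → Set
NoSplit P c S = ¬ (∃ λ a → ∃ λ b → S a × S b ×
  ((Y (P a) < Y c × Y c < Y (P b)) ⊎ (X (P a) < X c × X c < X (P b))))

Below : ℕ → ℕ → Set
Below i j = j < i

Single : ℕ → ℕ → Set
Single i j = j ≡ i

SepCond : Seq → ℕ → Set
SepCond P i = Separates P (P i) (Single (i ∸ 1)) (Below (i ∸ 1))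

PinSequence : Seq → ℕ → Set
PinSequence P m = GeneralPosition P m ×
  (∀ i → 1 ≤ i → i < m →
     ¬ InBox P i (P i) × (SepCond P i ⊎ NoSplit P (P i) (Below i)))

OrderIso : ∀ {n} → Seq → Permutation′ n → Set
OrderIso {n} P π = ∃ λ (σ : Permutation′ n) → ∀ (a b : Fin n) →
  ((X (P (toℕ a)) < X (P (toℕ b))) ⇔ (toℕ (σ ⟨$⟩ʳ a) < toℕ (σ ⟨$⟩ʳ b))) ×
  ((Y (P (toℕ a)) < Y (P (toℕ b))) ⇔ (val π (σ ⟨$⟩ʳ a) < val π (σ ⟨$⟩ʳ b)))

-- a pin representation of π: P 0, …, P (n-1) stand for p_1, …, p_n
PinRep : ∀ {n} → Seq → Permutation′ n → Set
PinRep {n} P π = OrderIso P π × PinSequence P n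

data Letter : Set where
  U D L R : Letter
  one two three four : Letter

Above BelowAll LeftOf RightOf : Seq → ℕ → Point → Set
Above    P i c = ∀ j → j < i → Y (P j) < Y c
BelowAll P i c = ∀ j → j < i → Y c < Y (P j)
LeftOf   P i c = ∀ j → j < i → X c < X (P j)
RightOf  P i c = ∀ j → j < i → X (P j) < X c

-- the i-th point (i ≥ 1) of the sequence Q = (p_0, p_1, …) is encoded by ℓ
Encodes : Seq → ℕ → Letter → Set
Encodes Q i U = 2 ≤ i × SepCond Q i × Above Q i (Q i)
Encodes Q i D = 2 ≤ i × SepCond Q i × BelowAll Q i (Q i)
Encodes Q i L = 2 ≤ i × SepCond Q i × LeftOf Q i (Q i)
Encodes Q i R = 2 ≤ i × SepCond Q i × RightOf Q i (Q i)
Encodes Q i one   = NoSplit Q (Q i) (Below i) × RightOf Q i (Q i) × Above Q i (Q i)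
Encodes Q i two   = NoSplit Q (Q i) (Below i) × LeftOf Q i (Q i) × Above Q i (Q i)
Encodes Q i three = NoSplit Q (Q i) (Below i) × LeftOf Q i (Q i) × BelowAll Q i (Q i)
Encodes Q i four  = NoSplit Q (Q i) (Below i) × RightOf Q i (Q i) × BelowAll Q i (Q i)

EncodesFrom : Seq → ℕ → List Letter → Set
EncodesFrom Q k []       = ⊤
EncodesFrom Q k (ℓ ∷ w)  = Encodes Q k ℓ × EncodesFrom Q (suc k) w

withOrigin : Point → Seq → Seq
withOrigin p0 P zero    = p0
withOrigin p0 P (suc i) = P i

IsPinWord : ∀ {n} → Permutation′ n → List Letter → Set
IsPinWord {n} π w = ∃ λ (P : Seq) → ∃ λ (p0 : Point) →
  PinRep P π × PinSequence (withOrigin p0 P) (suc n) ×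
  length w ≡ n × EncodesFrom (withOrigin p0 P) 1 w

data IsNumeral : Letter → Set where
  n1 : IsNumeral one
  n2 : IsNumeral two
  n3 : IsNumeral three
  n4 : IsNumeral four

data IsDirection : Letter → Set where
  dU : IsDirection U
  dD : IsDirection D
  dL : IsDirection L
  dR : IsDirection R

data Strict : List Letter → Set where
  strict : ∀ {x w} → IsNumeral x → All IsDirection w → Strict (x ∷ w)

data QuasiStrict : List Letter → Set where
  quasiStrict : ∀ {x y w} → IsNumeral x → IsNumeral y → All IsDirection w →
    QuasiStrict (x ∷ y ∷ w)

-- From the third point on, every point of a pin representation of a simple permutation
-- separates its predecessor from the earlier points.  Otherwise no later point could
-- enter the bounding box of the earlier points, even in one coordinate, so the
-- columns of the earlier points would form a proper block.  Hence the first letter of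
-- a pin word is a numeral, the second is arbitrary and all others are directions.
--
-- For the bound, a pin word is recovered from whether p₁ lies left of p₂ (2 choices),
-- its last letter (4 directions) and a code for its first two letters (6 choices).
-- Given the first two data, the cells of the diagram occupied by pₙ, pₙ₋₁, …, p₃ and
-- then p₁, p₂ are forced in turn: pₙ is extreme in the direction of the last letter,
-- and if some pₘ occupied different cells in two representations, p_{m+1} would
-- separate two earlier points from each other both ways.  Once two representations
-- agree point by point, each later letter is determined by the relative position of
-- its point, its predecessor and p₁ (never the origin), and the first two letters by
-- the code.

module Submission where

open import Defs
open import Data.Bool using (Bool; true; false; not; T)
open import Data.Empty using (⊥; ⊥-elim)
import Data.Fin as Fin
open import Data.Fin using (Fin; toℕ; zero; suc; combine; join; splitAt)
open import Data.Fin.Permutation using (Permutation′; _⟨$⟩ʳ_; _⟨$⟩ˡ_; inverseˡ; inverseʳ)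
open import Data.Fin.Properties using (toℕ-injective; toℕ<n; combine-injective; splitAt-join; pigeonhole)
open import Data.List using (List; []; _∷_; length; lookup; upTo)
open import Data.List.Extrema.Nat using (argmin; argmax; argmin-sel; argmax-sel; f[argmin]≤f[xs]; f[xs]≤f[argmax])
open import Data.List.Membership.Propositional.Properties using (∈-upTo⁺; ∈-upTo⁻; ∈-lookup)
open import Data.List.Properties using (∷-injective)
open import Data.List.Relation.Unary.All as All using (All; []; _∷_)
import Data.List.Relation.Unary.AllPairs as AllPairs
open import Data.List.Relation.Unary.Unique.Propositional using (Unique)
open import Data.Nat using (ℕ; zero; suc; _+_; _∸_; _≤_; _<_; _<ᵇ_; _<?_; _≤?_; _≟_; z≤n; s≤s; z<s; s≤s⁻¹)
open import Data.Nat.Properties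
open import Data.Product using (∃; _×_; _,_; proj₁; proj₂)
open import Data.Sum using (_⊎_; inj₁; inj₂; [_,_]′)
open import Data.Sum.Properties using (inj₁-injective; inj₂-injective)
open import Function.Base using (_∘_)
open import Function.Bundles using (Equivalence; _⇔_)
open import Relation.Binary using (tri<; tri≈; tri>)
open import Relation.Binary.PropositionalEquality
open import Relation.Nullary using (¬_; yes; no)

clamp : ∀ {k} → ℕ → Fin (suc k)
clamp zero = zero
clamp {zero} (suc a) = zero
clamp {suc k} (suc a) = suc (clamp a)

toℕ-clamp : ∀ {k} a → a ≤ k → toℕ (clamp {k} a) ≡ a
toℕ-clamp zero _ = refl
toℕ-clamp {suc k} (suc a) (s≤s a≤k) = cong suc (toℕ-clamp a a≤k)

clamp-toℕ : ∀ {k} (i : Fin (suc k)) → clamp (toℕ i) ≡ i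
clamp-toℕ zero = refl
clamp-toℕ {suc k} (suc i) = cong suc (clamp-toℕ i)

minimiser : (g : ℕ → ℕ) {m : ℕ} → 0 < m → ∃ λ j → j < m × ∀ i → i < m → g j ≤ g i
minimiser g {m} 0<m =
  j , [ (λ j≡0 → subst (_< m) (sym j≡0) 0<m) , ∈-upTo⁻ ]′ (argmin-sel g 0 (upTo m)) ,
  λ i i<m → All.lookup (f[argmin]≤f[xs] 0 (upTo m)) (∈-upTo⁺ i<m)
  where j = argmin g 0 (upTo m)

maximiser : (g : ℕ → ℕ) {m : ℕ} → 0 < m → ∃ λ j → j < m × ∀ i → i < m → g i ≤ g j
maximiser g {m} 0<m =
  j , [ (λ j≡0 → subst (_< m) (sym j≡0) 0<m) , ∈-upTo⁻ ]′ (argmax-sel g 0 (upTo m)) ,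
  λ i i<m → All.lookup (f[xs]≤f[argmax] 0 (upTo m)) (∈-upTo⁺ i<m)
  where j = argmax g 0 (upTo m)

lookup-unique : ∀ {A : Set} {xs : List A} → Unique xs → ∀ {i j} → i Fin.< j → lookup xs i ≢ lookup xs j
lookup-unique (distinct AllPairs.∷ _) {zero} {suc j} _ = All.lookup distinct (∈-lookup j)
lookup-unique (_ AllPairs.∷ unique) {suc i} {suc j} (s≤s i<j) = lookup-unique unique i<j

length-≤-injection : ∀ {A : Set} {Pr : A → Set} {n} (f : ∀ {x} → Pr x → Fin n) →
  (∀ {x y} (p : Pr x) (q : Pr y) → f p ≡ f q → x ≡ y) →
  ∀ {xs} → Unique xs → All Pr xs → length xs ≤ n
length-≤-injection {n = n} f f-injective {xs} unique all with length xs ≤? n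
... | yes ≤n = ≤n
... | no ≰n with pigeonhole (≰⇒> ≰n) (λ i → f (All.lookup all (∈-lookup i)))
...   | i , j , i<j , eq = ⊥-elim (lookup-unique unique i<j (f-injective _ _ eq))

join-injective : ∀ m n (x y : Fin m ⊎ Fin n) → join m n x ≡ join m n y → x ≡ y
join-injective m n x y eq = trans (sym (splitAt-join m n x)) (trans (cong (splitAt m) eq) (splitAt-join m n y))

-- Relative position of points along the two axes

data Axis : Set where
  horizontal vertical : Axis

coord : Axis → Point → ℕ
coord horizontal = X
coord vertical   = Y

perp : Axis → Axis
perp horizontal = vertical
perp vertical   = horizontal

axis-dichotomy : ∀ ax ax′ → ax′ ≡ ax ⊎ ax′ ≡ perp ax
axis-dichotomy horizontal horizontal = inj₁ refl
axis-dichotomy horizontal vertical   = inj₂ refl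
axis-dichotomy vertical   horizontal = inj₂ refl
axis-dichotomy vertical   vertical   = inj₁ refl

_<⟨_⟩_ : ℕ → Bool → ℕ → Set
m <⟨ true  ⟩ n = m < n
m <⟨ false ⟩ n = n < m

<⟨⟩-asym : ∀ {m n} s → m <⟨ s ⟩ n → n <⟨ s ⟩ m → ⊥
<⟨⟩-asym true  = <-asym
<⟨⟩-asym false = <-asym

<⟨⟩-flip : ∀ {m n} s → m <⟨ s ⟩ n → n <⟨ not s ⟩ m
<⟨⟩-flip true  m<n = m<n
<⟨⟩-flip false n<m = n<m

<⟨⟩-trans : ∀ {m n o} s → m <⟨ s ⟩ n → n <⟨ s ⟩ o → m <⟨ s ⟩ o
<⟨⟩-trans true  m<n n<o = <-trans m<n n<o
<⟨⟩-trans false n<m o<n = <-trans o<n n<m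

<⟨⟩-sense-unique : ∀ {m n} s t → m <⟨ s ⟩ n → m <⟨ t ⟩ n → s ≡ t
<⟨⟩-sense-unique true  true  _   _   = refl
<⟨⟩-sense-unique false false _   _   = refl
<⟨⟩-sense-unique true  false m<n n<m = ⊥-elim (<-asym m<n n<m)
<⟨⟩-sense-unique false true  n<m m<n = ⊥-elim (<-asym m<n n<m)

Direction : Set
Direction = Axis × Bool

Beyond : Direction → Point → Point → Set
Beyond (ax , s) p q = coord ax p <⟨ s ⟩ coord ax q

Between : Axis → Point → Point → Point → Set
Between ax q p r =
  (coord ax p < coord ax q × coord ax q < coord ax r) ⊎ (coord ax r < coord ax q × coord ax q < coord ax p)

beyond-beyond⇒between : ∀ ax s {p q r} → Beyond (ax , s) p q → Beyond (ax , s) q r → Between ax q p r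
beyond-beyond⇒between _ true  p<q q<r = inj₁ (p<q , q<r)
beyond-beyond⇒between _ false q<p r<q = inj₂ (r<q , q<p)

between-¬beyond-both : ∀ ax s {p q r} → Between ax q p r → Beyond (ax , s) p q → Beyond (ax , s) r q → ⊥
between-¬beyond-both _ true  (inj₁ (_ , q<r)) _ r<q = <-asym q<r r<q
between-¬beyond-both _ true  (inj₂ (_ , q<p)) p<q _ = <-asym q<p p<q
between-¬beyond-both _ false (inj₁ (p<q , _)) q<p _ = <-asym q<p p<q
between-¬beyond-both _ false (inj₂ (r<q , _)) _ q<r = <-asym q<r r<q

beyond-asym : ∀ δ {p q} → Beyond δ p q → Beyond δ q p → ⊥
beyond-asym (_ , s) = <⟨⟩-asym s

OrderPreserved : Point → Point → Point → Point → Set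
OrderPreserved p q p′ q′ = ∀ ax → coord ax p < coord ax q → coord ax p′ < coord ax q′

beyond-preserved : ∀ δ {p q p′ q′} → OrderPreserved p q p′ q′ → OrderPreserved q p q′ p′ →
  Beyond δ p q → Beyond δ p′ q′
beyond-preserved (ax , true)  pq _  = pq ax
beyond-preserved (ax , false) _  qp = qp ax

Preserves : Seq → Seq → (ℕ → Set) → Set
Preserves S S′ I = ∀ {x y} → I x → I y → OrderPreserved (S x) (S y) (S′ x) (S′ y)

beyond-preserves : ∀ δ {S S′ I x y} → Preserves S S′ I → I x → I y → Beyond δ (S x) (S y) → Beyond δ (S′ x) (S′ y)
beyond-preserves δ pres ix iy = beyond-preserved δ (pres ix iy) (pres iy ix)

Extreme : Direction → Seq → ℕ → Set
Extreme δ S i = ∀ j → j < i → Beyond δ (S j) (S i)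

Separation : Seq → ℕ → Direction → Set
Separation S i δ = Beyond δ (S i) (S (suc i)) × (∀ j → j < i → Beyond δ (S (suc i)) (S j))

sepCond⇒separation : ∀ {S i} → SepCond S (suc i) → ∃ (Separation S i)
sepCond⇒separation (inj₁ (below , above))               = (vertical , true) , below _ refl , above
sepCond⇒separation (inj₂ (inj₁ (above , below)))        = (vertical , false) , above _ refl , below
sepCond⇒separation (inj₂ (inj₂ (inj₁ (left , right))))  = (horizontal , true) , left _ refl , right
sepCond⇒separation (inj₂ (inj₂ (inj₂ (right , left)))) = (horizontal , false) , right _ refl , left

OneSide : Axis → Seq → ℕ → Point → Set
OneSide ax S m c = ∃ λ s → ∀ j → j < m → Beyond (ax , s) (S j) c

Detached : Seq → ℕ → ℕ → Set
Detached S m i = ∀ ax → OneSide ax S m (S i)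

Spanned : Axis → Seq → ℕ → Point → Set
Spanned ax S m c =
  (∃ λ j → j < m × coord ax (S j) ≤ coord ax c) × (∃ λ j → j < m × coord ax c ≤ coord ax (S j))

spanned⇒inBox : ∀ ax {S m c} → Spanned ax S m c → Spanned (perp ax) S m c → InBox S m c
spanned⇒inBox horizontal (l , r) (b , t) = l , r , b , t
spanned⇒inBox vertical   (b , t) (l , r) = l , r , b , t

between⇒spanned : ∀ ax {S m u v c} → u < m → v < m → Between ax c (S u) (S v) → Spanned ax S m c
between⇒spanned _ u<m v<m (inj₁ (u<c , c<v)) = (_ , u<m , <⇒≤ u<c) , (_ , v<m , <⇒≤ c<v)
between⇒spanned _ u<m v<m (inj₂ (v<c , c<u)) = (_ , v<m , <⇒≤ v<c) , (_ , u<m , <⇒≤ c<u)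

oneSide : ∀ ax {S m c} → 0 < m → (∀ j → j < m → coord ax (S j) ≢ coord ax c) →
  (∀ a b → a < m → b < m → coord ax (S a) < coord ax c → ¬ coord ax c < coord ax (S b)) →
  OneSide ax S m c
oneSide ax {S} {m} {c} 0<m distinct straddle with <-cmp (coord ax (S 0)) (coord ax c)
... | tri< s0<c _ _ = true , λ j j<m →
  ≤∧≢⇒< (≮⇒≥ (straddle 0 j 0<m j<m s0<c)) (distinct j j<m)
... | tri≈ _ s0≡c _ = ⊥-elim (distinct 0 0<m s0≡c)
... | tri> _ _ c<s0 = false , λ j j<m →
  ≤∧≢⇒< (≮⇒≥ (λ sj<c → straddle j 0 j<m 0<m sj<c c<s0)) (≢-sym (distinct j j<m))

¬spanned⇒oneSide : ∀ ax {S m c} → 0 < m → ¬ Spanned ax S m c → OneSide ax S m c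
¬spanned⇒oneSide ax 0<m ¬spanned = oneSide ax 0<m
  (λ j j<m sj≡c → ¬spanned ((j , j<m , ≤-reflexive sj≡c) , (j , j<m , ≤-reflexive (sym sj≡c))))
  (λ a b a<m b<m a<c c<b → ¬spanned ((a , a<m , <⇒≤ a<c) , (b , b<m , <⇒≤ c<b)))

oneSide-restrict : ∀ ax {S m m′ c} → m ≤ m′ → OneSide ax S m′ c → OneSide ax S m c
oneSide-restrict _ m≤m′ (s , beyond) = s , λ j j<m → beyond j (<-≤-trans j<m m≤m′)

distinct-along : ∀ ax {p q} → X p ≢ X q × Y p ≢ Y q → coord ax p ≢ coord ax q
distinct-along horizontal = proj₁
distinct-along vertical   = proj₂

straddle-along : ∀ ax {p q c} → coord ax p < coord ax c → coord ax c < coord ax q →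
  (Y p < Y c × Y c < Y q) ⊎ (X p < X c × X c < X q)
straddle-along horizontal p<c c<q = inj₂ (p<c , c<q)
straddle-along vertical   p<c c<q = inj₁ (p<c , c<q)

noSplit⇒detached : ∀ {S n m i} → GeneralPosition S n → 0 < m → m ≤ i → i < n →
  NoSplit S (S i) (Below i) → Detached S m i
noSplit⇒detached {m = m} gp 0<m m≤i i<n noSplit ax = oneSide ax 0<m
  (λ j j<m → distinct-along ax (gp j _ (<-trans (<-≤-trans j<m m≤i) i<n) i<n
                                    (<⇒≢ (<-≤-trans j<m m≤i))))
  (λ a b a<m b<m a<c c<b → noSplit (a , b , earlier a<m , earlier b<m , straddle-along ax a<c c<b))
  where
  earlier : ∀ {j} → j < m → j < _
  earlier j<m = <-≤-trans j<m m≤i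

separation⇒detached : ∀ {S m i} δ → 0 < i → m ≤ i → ¬ InBox S (suc i) (S (suc i)) →
  Separation S i δ → Detached S m (suc i)
separation⇒detached {S} {i = i} (ax , s) 0<i m≤i ¬inBox (past-last , before-rest) ax′
  with axis-dichotomy ax ax′
... | inj₁ refl = oneSide-restrict ax m≤i (not s , λ j j<i →
      <⟨⟩-flip {coord ax (S (suc i))} {coord ax (S j)} s (before-rest j j<i))
... | inj₂ refl = oneSide-restrict (perp ax) (m≤n⇒m≤1+n m≤i) (¬spanned⇒oneSide (perp ax) z<s
      (λ spanned⊥ → ¬inBox (spanned⇒inBox ax spanned∥ spanned⊥)))
  where
  spanned∥ : Spanned ax S (suc i) (S (suc i))
  spanned∥ = between⇒spanned ax ≤-refl (<-trans 0<i ≤-refl)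
               (beyond-beyond⇒between ax s past-last (before-rest 0 0<i))

LineSeparates : Direction → Seq → ℕ → ℕ → ℕ → ℕ → Set
LineSeparates δ S w u v z = Beyond δ (S u) (S w) × Beyond δ (S w) (S v) × Beyond δ (S w) (S z)

separation⇒lineSeparates : ∀ δ {S m v z} → Separation S m δ → v < m → z < m → LineSeparates δ S (suc m) m v z
separation⇒lineSeparates _ (past , before) v<m z<m = past , before _ v<m , before _ z<m

-- Along one line z would lie on both sides; along perpendicular lines w lies in the box of u, v.
crossed-separations : ∀ δ δ′ {S i w u v z} → u < i → v < i → ¬ InBox S i (S w) →
  LineSeparates δ S w u v z → ¬ LineSeparates δ′ S w v u z
crossed-separations (ax , s) (ax′ , s′) u<i v<i ¬inBox (u<w , w<v , w<z) (v<w , w<u , w<z′)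
  with axis-dichotomy ax ax′
... | inj₁ refl with <⟨⟩-sense-unique s s′ w<z w<z′
...   | refl = <⟨⟩-asym s u<w w<u
crossed-separations (ax , s) (ax′ , s′) u<i v<i ¬inBox (u<w , w<v , _) (v<w , w<u , _) | inj₂ refl =
  ¬inBox (spanned⇒inBox ax (between⇒spanned ax u<i v<i (beyond-beyond⇒between ax s u<w w<v))
                           (between⇒spanned (perp ax) v<i u<i (beyond-beyond⇒between (perp ax) s′ v<w w<u)))

consecutive-separations : ∀ ax s t {S i} → 0 < i → Separation S i (ax , s) → ¬ Separation S (suc i) (ax , t)
consecutive-separations _ true  true  _   (past , _) (past′ , before′) = <-asym (<-trans past past′) (before′ _ ≤-refl)
consecutive-separations _ false false _   (past , _) (past′ , before′) = <-asym (<-trans past′ past) (before′ _ ≤-refl)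
consecutive-separations _ true  false 0<i (_ , before) (past′ , before′) =
  <-asym (<-trans (before 0 0<i) (before′ 0 (<-trans 0<i ≤-refl))) past′
consecutive-separations _ false true  0<i (_ , before) (past′ , before′) =
  <-asym (<-trans (before′ 0 (<-trans 0<i ≤-refl)) (before 0 0<i)) past′

orientation : Seq → Bool
orientation P = X (P 0) <ᵇ X (P 1)

-- Cells of the diagram occupied by a pin representation

OrderIsoVia : ∀ {n} → Seq → Permutation′ n → Permutation′ n → Set
OrderIsoVia {n} P π σ = ∀ (a b : Fin n) →
  ((X (P (toℕ a)) < X (P (toℕ b))) ⇔ (toℕ (σ ⟨$⟩ʳ a) < toℕ (σ ⟨$⟩ʳ b))) ×
  ((Y (P (toℕ a)) < Y (P (toℕ b))) ⇔ (val π (σ ⟨$⟩ʳ a) < val π (σ ⟨$⟩ʳ b)))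

diagramCoord : ∀ {n} → Permutation′ n → Axis → Fin n → ℕ
diagramCoord π horizontal = toℕ
diagramCoord π vertical   = val π

module Ranks {k} (π : Permutation′ (suc k)) (P : Seq) (σ : Permutation′ (suc k)) (iso : OrderIsoVia P π σ) where

  -- the column of π's diagram represented by P a (junk for a > k)
  cell : ℕ → Fin (suc k)
  cell a = σ ⟨$⟩ʳ clamp a

  rank : Axis → ℕ → ℕ
  rank ax a = diagramCoord π ax (cell a)

  col : ℕ → ℕ
  col = rank horizontal

  rank≡ : ∀ ax a → rank ax a ≡ diagramCoord π ax (clamp (col a))
  rank≡ ax a = cong (diagramCoord π ax) (sym (clamp-toℕ (cell a)))

  col<N : ∀ a → col a < suc k
  col<N a = toℕ<n (cell a)

  private
    iso-along : ∀ ax (i j : Fin (suc k)) → (coord ax (P (toℕ i)) < coord ax (P (toℕ j))) ⇔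
                  (diagramCoord π ax (σ ⟨$⟩ʳ i) < diagramCoord π ax (σ ⟨$⟩ʳ j))
    iso-along horizontal i j = proj₁ (iso i j)
    iso-along vertical   i j = proj₂ (iso i j)

    P-clamp : ∀ {a} → a < suc k → P (toℕ (clamp {k} a)) ≡ P a
    P-clamp a<N = cong P (toℕ-clamp _ (s≤s⁻¹ a<N))

  coord<⇒rank< : ∀ ax {a b} → a < suc k → b < suc k → coord ax (P a) < coord ax (P b) → rank ax a < rank ax b
  coord<⇒rank< ax a<N b<N lt = Equivalence.to (iso-along ax (clamp _) (clamp _))
    (subst₂ (λ p q → coord ax p < coord ax q) (sym (P-clamp a<N)) (sym (P-clamp b<N)) lt)

  rank<⇒coord< : ∀ ax {a b} → a < suc k → b < suc k → rank ax a < rank ax b → coord ax (P a) < coord ax (P b)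
  rank<⇒coord< ax a<N b<N lt = subst₂ (λ p q → coord ax p < coord ax q) (P-clamp a<N) (P-clamp b<N)
    (Equivalence.from (iso-along ax (clamp _) (clamp _)) lt)

  col-injective : ∀ {a b} → a < suc k → b < suc k → col a ≡ col b → a ≡ b
  col-injective {a} {b} a<N b<N eq = begin
    a                            ≡⟨ toℕ-clamp a (s≤s⁻¹ a<N) ⟨
    toℕ (clamp {k} a)            ≡⟨ cong toℕ (inverseˡ σ) ⟨
    toℕ (σ ⟨$⟩ˡ cell a)          ≡⟨ cong (λ i → toℕ (σ ⟨$⟩ˡ i)) (toℕ-injective eq) ⟩
    toℕ (σ ⟨$⟩ˡ cell b)          ≡⟨ cong toℕ (inverseˡ σ) ⟩
    toℕ (clamp {k} b)            ≡⟨ toℕ-clamp b (s≤s⁻¹ b<N) ⟩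
    b                            ∎
    where open ≡-Reasoning

  col-surjective : ∀ {u} → u < suc k → ∃ λ a → a < suc k × col a ≡ u
  col-surjective {u} u<N = toℕ a , toℕ<n a , (begin
    toℕ (σ ⟨$⟩ʳ clamp (toℕ a)) ≡⟨ cong (λ i → toℕ (σ ⟨$⟩ʳ i)) (clamp-toℕ a) ⟩
    toℕ (σ ⟨$⟩ʳ a)             ≡⟨ cong toℕ (inverseʳ σ) ⟩
    toℕ (clamp {k} u)          ≡⟨ toℕ-clamp u (s≤s⁻¹ u<N) ⟩
    u                          ∎)
    where
    open ≡-Reasoning
    a = σ ⟨$⟩ˡ clamp u

  value-taken : ∀ {v} → v < suc k → ∃ λ b → b < suc k × val π (cell b) ≡ v
  value-taken {v} v<N with col-surjective (toℕ<n (π ⟨$⟩ˡ clamp v))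
  ... | b , b<N , colb≡q = b , b<N , (begin
    val π (cell b)            ≡⟨ cong (val π) (toℕ-injective colb≡q) ⟩
    val π (π ⟨$⟩ˡ clamp v)     ≡⟨ cong toℕ (inverseʳ π) ⟩
    toℕ (clamp {k} v)         ≡⟨ toℕ-clamp v (s≤s⁻¹ v<N) ⟩
    v                         ∎)
    where open ≡-Reasoning

  col-taken-before : ∀ m {u} → u < suc k → (∀ j → m ≤ j → j < suc k → col j ≢ u) →
    ∃ λ b → b < m × col b ≡ u
  col-taken-before m u<N later-elsewhere with col-surjective u<N
  ... | b , b<N , colb≡u with b <? m
  ...   | yes b<m = b , b<m , colb≡u
  ...   | no b≮m = ⊥-elim (later-elsewhere b (≮⇒≥ b≮m) b<N colb≡u)

  module DetachedPrefix {m} (0<m : 0 < m) (m<N : m < suc k) (detached : ∀ j → m ≤ j → j < suc k → Detached P m j) where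

    leftmost rightmost : ℕ
    leftmost  = proj₁ (minimiser col 0<m)
    rightmost = proj₁ (maximiser col 0<m)

    leftmost<m : leftmost < m
    leftmost<m = proj₁ (proj₂ (minimiser col 0<m))

    rightmost<m : rightmost < m
    rightmost<m = proj₁ (proj₂ (maximiser col 0<m))

    leftmost-≤ : ∀ i → i < m → col leftmost ≤ col i
    leftmost-≤ = proj₂ (proj₂ (minimiser col 0<m))

    ≤-rightmost : ∀ i → i < m → col i ≤ col rightmost
    ≤-rightmost = proj₂ (proj₂ (maximiser col 0<m))

    private
      in-range : ∀ {i} → i < m → i < suc k
      in-range i<m = <-trans i<m m<N

    prefix-fills : ∀ {u} → col leftmost ≤ u → u ≤ col rightmost → ∃ λ b → b < m × col b ≡ u
    prefix-fills {u} l≤u u≤r = col-taken-before m (≤-<-trans u≤r (col<N rightmost)) outside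
      where
      outside : ∀ j → m ≤ j → j < suc k → col j ≢ u
      outside j m≤j j<N colj≡u with detached j m≤j j<N horizontal
      ... | true , right = <⇒≱ (coord<⇒rank< horizontal (in-range rightmost<m) j<N (right rightmost rightmost<m))
                                 (subst (_≤ col rightmost) (sym colj≡u) u≤r)
      ... | false , left = <⇒≱ (coord<⇒rank< horizontal j<N (in-range leftmost<m) (left leftmost leftmost<m))
                                 (subst (col leftmost ≤_) (sym colj≡u) l≤u)

    prefix-cell : ∀ q → col leftmost ≤ toℕ q → toℕ q ≤ col rightmost → ∃ λ b → b < m × cell b ≡ q
    prefix-cell q l≤q q≤r with prefix-fills l≤q q≤r
    ... | b , b<m , colb≡q = b , b<m , toℕ-injective colb≡q

    row-not-between-prefix : ∀ {b ja jc} → m ≤ b → b < suc k → ja < m → jc < m →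
      rank vertical ja ≤ rank vertical b → rank vertical b ≤ rank vertical jc → ⊥
    row-not-between-prefix {b} {ja} {jc} m≤b b<N ja<m jc<m a≤b b≤c with detached b m≤b b<N vertical
    ... | true  , above = <⇒≱ (coord<⇒rank< vertical (in-range jc<m) b<N (above jc jc<m)) b≤c
    ... | false , below = <⇒≱ (coord<⇒rank< vertical b<N (in-range ja<m) (below ja ja<m)) a≤b

    prefix-interval : IsInterval (ImageOf π (cell leftmost) (cell rightmost))
    prefix-interval _ _ _ (qa , l≤qa , qa≤r , refl) (qc , l≤qc , qc≤r , refl) a≤v v≤c
      with value-taken (≤-<-trans v≤c (toℕ<n (π ⟨$⟩ʳ qc)))
    ... | b , b<N , refl with b <? m
    ...   | yes b<m = cell b , leftmost-≤ b b<m , ≤-rightmost b b<m , refl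
    ...   | no b≮m with prefix-cell qa l≤qa qa≤r | prefix-cell qc l≤qc qc≤r
    ...     | ja , ja<m , refl | jc , jc<m , refl =
              ⊥-elim (row-not-between-prefix (≮⇒≥ b≮m) b<N ja<m jc<m a≤v v≤c)

    prefix-block : IsBlock π (cell leftmost) (cell rightmost)
    prefix-block = ≤-rightmost leftmost leftmost<m , prefix-interval

    single-column : col leftmost ≡ col rightmost → ∀ i → i < m → col i ≡ col leftmost
    single-column l≡r i i<m = ≤-antisym (subst (col i ≤_) (sym l≡r) (≤-rightmost i i<m)) (leftmost-≤ i i<m)

    breaks-simplicity : Simple π → 2 ≤ m → ⊥
    breaks-simplicity (_ , simple) 2≤m with simple _ _ prefix-block
    ... | inj₁ l≡r = 0≢1+n (col-injective (in-range 0<m) (in-range 2≤m)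
                              (trans (single-column l≡r 0 0<m) (sym (single-column l≡r 1 2≤m))))
    ... | inj₂ (l≡0 , r+1≡N) with prefix-fills (subst (_≤ col m) (sym l≡0) z≤n)
                                               (s≤s⁻¹ (subst (col m <_) (sym r+1≡N) (col<N m)))
    ...   | b , b<m , colb≡colm = <-irrefl (col-injective (in-range b<m) m<N colb≡colm) b<m

-- Pin representations of simple permutations

simple⇒2≤k : ∀ {k} (π : Permutation′ (suc k)) → Simple π → 2 ≤ k
simple⇒2≤k π (4≤N , _) = ≤-trans (n≤1+n 2) (s≤s⁻¹ 4≤N)

module PinRepOfSimple {k} (π : Permutation′ (suc k)) (simple : Simple π)
                      (P : Seq) (σ : Permutation′ (suc k)) (iso : OrderIsoVia P π σ) (pins : PinSequence P (suc k)) where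
  open Ranks π P σ iso

  later-detached : ∀ {m} → 0 < m → m < suc k → NoSplit P (P m) (Below m) →
    ∀ j → m ≤ j → j < suc k → Detached P m j
  later-detached 0<m m<N noSplit j m≤j j<N with m≤n⇒m<n∨m≡n m≤j
  ... | inj₂ refl = noSplit⇒detached (proj₁ pins) 0<m ≤-refl j<N noSplit
  later-detached 0<m m<N noSplit (suc i) _ j<N | inj₁ (s≤s m≤i)
    with proj₂ pins (suc i) (s≤s z≤n) j<N
  ... | ¬inBox , inj₁ sepCond = separation⇒detached δ (<-≤-trans 0<m m≤i) m≤i ¬inBox separation
    where
    δ = proj₁ (sepCond⇒separation sepCond)
    separation = proj₂ (sepCond⇒separation sepCond)
  ... | _ , inj₂ noSplit′ = noSplit⇒detached (proj₁ pins) 0<m (m≤n⇒m≤1+n m≤i) j<N noSplit′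

  late-noSplit-impossible : ∀ {m} → 2 ≤ m → m < suc k → ¬ NoSplit P (P m) (Below m)
  late-noSplit-impossible 2≤m m<N noSplit =
    DetachedPrefix.breaks-simplicity 0<m m<N (later-detached 0<m m<N noSplit) simple 2≤m
    where
    0<m = <-≤-trans z<s 2≤m

  late-separation : ∀ {m} → 2 ≤ m → m < suc k → SepCond P m
  late-separation 2≤m m<N with proj₂ (proj₂ pins _ (<-≤-trans z<s 2≤m) m<N)
  ... | inj₁ sepCond = sepCond
  ... | inj₂ noSplit = ⊥-elim (late-noSplit-impossible 2≤m m<N noSplit)

-- Letters of pin words

axis : Letter → Axis
axis U = vertical
axis D = vertical
axis _ = horizontal

sense : Letter → Bool
sense D = false
sense L = false
sense _ = true

direction : Letter → Direction
direction ℓ = axis ℓ , sense ℓ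

letter : Direction → Letter
letter (vertical   , true)  = U
letter (vertical   , false) = D
letter (horizontal , true)  = R
letter (horizontal , false) = L

letter-direction : ∀ {ℓ} → IsDirection ℓ → letter (direction ℓ) ≡ ℓ
letter-direction dU = refl
letter-direction dD = refl
letter-direction dL = refl
letter-direction dR = refl

corner : Letter → Axis → Bool
corner two   horizontal = false
corner three _          = false
corner four  vertical   = false
corner _     _          = true

quadrant : Bool → Bool → Letter
quadrant true  true  = one
quadrant false true  = two
quadrant false false = three
quadrant true  false = four

quadrant-corner : ∀ {ℓ} → IsNumeral ℓ → quadrant (corner ℓ horizontal) (corner ℓ vertical) ≡ ℓ
quadrant-corner n1 = refl
quadrant-corner n2 = refl
quadrant-corner n3 = refl
quadrant-corner n4 = refl

letter-kind : ∀ ℓ → IsNumeral ℓ ⊎ IsDirection ℓ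
letter-kind U     = inj₂ dU
letter-kind D     = inj₂ dD
letter-kind L     = inj₂ dL
letter-kind R     = inj₂ dR
letter-kind one   = inj₁ n1
letter-kind two   = inj₁ n2
letter-kind three = inj₁ n3
letter-kind four  = inj₁ n4

encodes-direction : ∀ {S i ℓ} → IsDirection ℓ → Encodes S i ℓ →
  2 ≤ i × SepCond S i × Extreme (direction ℓ) S i
encodes-direction dU e = e
encodes-direction dD e = e
encodes-direction dL e = e
encodes-direction dR e = e

encodes-numeral : ∀ {S i ℓ} → IsNumeral ℓ → Encodes S i ℓ →
  NoSplit S (S i) (Below i) × ∀ ax → Extreme (ax , corner ℓ ax) S i
encodes-numeral n1 (noSplit , right , up)   = noSplit , λ { horizontal → right ; vertical → up }
encodes-numeral n2 (noSplit , left  , up)   = noSplit , λ { horizontal → left  ; vertical → up }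
encodes-numeral n3 (noSplit , left  , down) = noSplit , λ { horizontal → left  ; vertical → down }
encodes-numeral n4 (noSplit , right , down) = noSplit , λ { horizontal → right ; vertical → down }

first-letter-numeral : ∀ {S ℓ} → Encodes S 1 ℓ → IsNumeral ℓ
first-letter-numeral {ℓ = ℓ} e with letter-kind ℓ
... | inj₁ numeral   = numeral
... | inj₂ direction = ⊥-elim (<-irrefl refl (proj₁ (encodes-direction direction e)))

extreme-¬separation : ∀ ax s t {S i} → 0 < i → Extreme (ax , t) S (suc i) → ¬ Separation S i (ax , s)
extreme-¬separation ax s t 0<i extreme (past , before) with <⟨⟩-sense-unique s t past (extreme _ ≤-refl)
... | refl = <⟨⟩-asym s (extreme 0 (<-trans 0<i ≤-refl)) (before 0 0<i)

direction-separation : ∀ {S i ℓ} → IsDirection ℓ → Encodes S (suc i) ℓ →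
  Extreme (direction ℓ) S (suc i) × ∃ λ s → Separation S i (perp (axis ℓ) , s)
direction-separation {ℓ = ℓ} d e with encodes-direction d e
... | s≤s 1≤i , sepCond , extreme with sepCond⇒separation sepCond
...   | (ax , s) , separation with axis-dichotomy (axis ℓ) ax
...     | inj₁ refl = ⊥-elim (extreme-¬separation ax s (sense ℓ) 1≤i extreme separation)
...     | inj₂ refl = extreme , s , separation

direction-injective : ∀ {ℓ ℓ′} → IsDirection ℓ → IsDirection ℓ′ → direction ℓ ≡ direction ℓ′ → ℓ ≡ ℓ′
direction-injective d d′ eq = trans (sym (letter-direction d)) (trans (cong letter eq) (letter-direction d′))

numeral-injective : ∀ {ℓ ℓ′} → IsNumeral ℓ → IsNumeral ℓ′ → (∀ ax → corner ℓ ax ≡ corner ℓ′ ax) → ℓ ≡ ℓ′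
numeral-injective n n′ eq =
  trans (sym (quadrant-corner n)) (trans (cong₂ quadrant (eq horizontal) (eq vertical)) (quadrant-corner n′))

-- A direction letter is read off from its point a, its predecessor p and any earlier point z,
-- none of which is the origin.
Profile : Direction → Seq → ℕ → ℕ → ℕ → Set
Profile (ax , s) S a p z =
  Beyond (ax , s) (S p) (S a) × Beyond (ax , s) (S z) (S a) × Between (perp ax) (S a) (S p) (S z)

direction-profile : ∀ {S i z ℓ} → IsDirection ℓ → Encodes S (suc i) ℓ → z < i → Profile (direction ℓ) S (suc i) i z
direction-profile {ℓ = ℓ} d e z<i with direction-separation d e
... | extreme , s , past , before =
  extreme _ ≤-refl , extreme _ (m<n⇒m<1+n z<i) , beyond-beyond⇒between (perp (axis ℓ)) s past (before _ z<i)

profile-unique : ∀ δ δ′ {S a p z} → Profile δ S a p z → Profile δ′ S a p z → δ ≡ δ′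
profile-unique (ax , s) (ax′ , s′) (p<a , _ , between) (p<a′ , z<a′ , _) with axis-dichotomy ax ax′
... | inj₁ refl = cong (ax ,_) (<⟨⟩-sense-unique s s′ p<a p<a′)
... | inj₂ refl = ⊥-elim (between-¬beyond-both (perp ax) s′ between p<a′ z<a′)

profile-preserved : ∀ δ {S S′ I a p z} → Preserves S S′ I → I a → I p → I z → Profile δ S a p z → Profile δ S′ a p z
profile-preserved (ax , s) {S} {S′} {a = a} {p} {z} pres ia ip iz (p<a , z<a , between) =
  beyond-preserves (ax , s) {x = p} {a} pres ip ia p<a ,
  beyond-preserves (ax , s) {x = z} {a} pres iz ia z<a ,
  between′ between
  where
  between′ : Between (perp ax) (S a) (S p) (S z) → Between (perp ax) (S′ a) (S′ p) (S′ z)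
  between′ (inj₁ (p<a , a<z)) = inj₁ (pres ip ia (perp ax) p<a , pres ia iz (perp ax) a<z)
  between′ (inj₂ (z<a , a<p)) = inj₂ (pres iz ia (perp ax) z<a , pres ia ip (perp ax) a<p)

second-axis : ∀ {S b c} → IsDirection b → IsDirection c → Encodes S 2 b → Encodes S 3 c → axis b ≡ perp (axis c)
second-axis {S} {b} {c} db dc eb ec with direction-separation db eb | direction-separation dc ec
... | _ , s , separation | _ , t , separation′ with axis-dichotomy (axis c) (axis b)
...   | inj₂ b⊥c  = b⊥c
...   | inj₁ b∥c  = ⊥-elim (consecutive-separations (perp (axis c)) s t z<s
                      (subst (λ ax → Separation S 1 (perp ax , s)) b∥c separation) separation′)

numeral-side : ∀ ax s {S a} → IsNumeral a → Encodes S 1 a → Separation S 1 (ax , s) → corner a ax ≡ not s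
numeral-side ax s n e (past , before) =
  <⟨⟩-sense-unique (corner _ ax) (not s) (proj₂ (encodes-numeral n e) ax 0 z<s)
    (<⟨⟩-flip s (<⟨⟩-trans s past (before 0 z<s)))

noSplit-withOrigin : ∀ {P p0 i} → NoSplit (withOrigin p0 P) (P i) (Below (suc i)) → NoSplit P (P i) (Below i)
noSplit-withOrigin noSplit (a , b , a<i , b<i , straddle) = noSplit (suc a , suc b , s≤s a<i , s≤s b<i , straddle)

finalLetter : Letter → List Letter → Letter
finalLetter ℓ []      = ℓ
finalLetter _ (ℓ ∷ w) = finalLetter ℓ w

encodes-final : ∀ {S i} ℓ w → EncodesFrom S i (ℓ ∷ w) → Encodes S (i + length w) (finalLetter ℓ w)
encodes-final {S} {i} ℓ []      (e , _)  = subst (λ j → Encodes S j ℓ) (sym (+-identityʳ i)) e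
encodes-final {S} {i} _ (ℓ ∷ w) (_ , es) =
  subst (λ j → Encodes S j (finalLetter ℓ w)) (sym (+-suc i (length w))) (encodes-final ℓ w es)

module WordOfPinRep {k} (π : Permutation′ (suc k)) (simple : Simple π)
                        (P : Seq) (σ : Permutation′ (suc k)) (iso : OrderIsoVia P π σ) (pins : PinSequence P (suc k)) (p0 : Point) where
  open PinRepOfSimple π simple P σ iso pins

  late-letter-direction : ∀ {i ℓ} → 2 ≤ i → i < suc k → Encodes (withOrigin p0 P) (suc i) ℓ → IsDirection ℓ
  late-letter-direction {ℓ = ℓ} 2≤i i<N e with letter-kind ℓ
  ... | inj₂ direction = direction
  ... | inj₁ numeral   =
    ⊥-elim (late-noSplit-impossible 2≤i i<N (noSplit-withOrigin (proj₁ (encodes-numeral numeral e))))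

  final-letter-direction : ∀ {ℓ} → Encodes (withOrigin p0 P) (suc k) ℓ → IsDirection ℓ × Extreme (direction ℓ) P k
  final-letter-direction e = d , λ j j<k → proj₂ (proj₂ (encodes-direction d e)) (suc j) (s≤s j<k)
    where
    d = late-letter-direction (simple⇒2≤k π simple) ≤-refl e

  late-letters-directions : ∀ {i} ws → 2 ≤ i → i + length ws ≡ suc k →
    EncodesFrom (withOrigin p0 P) (suc i) ws → All IsDirection ws
  late-letters-directions []       _   _   _        = []
  late-letters-directions {i} (ℓ ∷ ws) 2≤i len (e , es) =
    late-letter-direction 2≤i (subst (i <_) len (m<m+n i z<s)) e ∷
    late-letters-directions ws (m≤n⇒m≤1+n 2≤i) (trans (sym (+-suc i (length ws))) len) es

  pinWord-shape : ∀ w → length w ≡ suc k → EncodesFrom (withOrigin p0 P) 1 w → Strict w ⊎ QuasiStrict w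
  pinWord-shape (a ∷ b ∷ w) len (ea , eb , ew) =
    [ (λ nb → inj₂ (quasiStrict (first-letter-numeral ea) nb rest))
    , (λ db → inj₁ (strict (first-letter-numeral ea) (db ∷ rest))) ]′ (letter-kind b)
    where
    rest = late-letters-directions w ≤-refl len ew
  pinWord-shape (a ∷ []) refl _ with simple⇒2≤k π simple
  ... | ()

-- Two pin representations of the same permutation

module RankComparison {k} (π : Permutation′ (suc k))
                      (P : Seq) (σ : Permutation′ (suc k)) (iso : OrderIsoVia P π σ)
                      (P′ : Seq) (σ′ : Permutation′ (suc k)) (iso′ : OrderIsoVia P′ π σ′) where
  module A = Ranks π P σ iso
  module B = Ranks π P′ σ′ iso′

  SameCell : ℕ → ℕ → Set
  SameCell a a′ = a < suc k × a′ < suc k × B.col a ≡ A.col a′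

  same-cell-preserves : ∀ {a a′ b b′} → SameCell a a′ → SameCell b b′ → OrderPreserved (P′ a) (P′ b) (P a′) (P b′)
  same-cell-preserves {a} {a′} {b} {b′} (a<N , a′<N , ea) (b<N , b′<N , eb) ax lt =
    A.rank<⇒coord< ax a′<N b′<N (subst₂ _<_ (same-rank ea) (same-rank eb) (B.coord<⇒rank< ax a<N b<N lt))
    where
    same-rank : ∀ {c c′} → B.col c ≡ A.col c′ → B.rank ax c ≡ A.rank ax c′
    same-rank {c} {c′} e = trans (B.rank≡ ax c) (trans (cong (λ u → diagramCoord π ax (clamp u)) e) (sym (A.rank≡ ax c′)))

  AgreeFrom : ℕ → Set
  AgreeFrom m = ∀ j → m ≤ j → j < suc k → A.col j ≡ B.col j

  moved-before : ∀ {m i} → m < suc k → i ≤ m → AgreeFrom (suc m) → B.col m ≢ A.col i →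
    ∃ λ b → b < m × B.col b ≡ A.col i
  moved-before {m} {i} m<N i≤m agree mismatch = B.col-taken-before m (A.col<N i) elsewhere
    where
    elsewhere : ∀ j → m ≤ j → j < suc k → B.col j ≢ A.col i
    elsewhere j m≤j j<N eq with m≤n⇒m<n∨m≡n m≤j
    ... | inj₂ refl = mismatch eq
    ... | inj₁ m<j  = <-irrefl (sym (A.col-injective j<N (≤-<-trans i≤m m<N) (trans (agree j m<j j<N) eq)))
                               (≤-<-trans i≤m m<j)

  swap-breaks-orientation : 1 < suc k → orientation P ≡ orientation P′ → B.col 0 ≡ A.col 1 → B.col 1 ≡ A.col 0 →
    ¬ X (P 0) < X (P 1)
  swap-breaks-orientation 1<N same e0 e1 lt = <-asym lt
    (same-cell-preserves (z<s , 1<N , e0) (1<N , z<s , e1) horizontal (<ᵇ⇒< _ _ (subst T same (<⇒<ᵇ lt))))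

  beyond-transfers : ∀ δ {a a′ b b′} → SameCell a a′ → SameCell b b′ → Beyond δ (P′ a) (P′ b) → Beyond δ (P a′) (P b′)
  beyond-transfers δ ca cb = beyond-preserved δ (same-cell-preserves ca cb) (same-cell-preserves cb ca)

  lineSeparates-transfers : ∀ δ {w w′ u u′ v v′ z z′} → SameCell w w′ → SameCell u u′ → SameCell v v′ → SameCell z z′ →
    LineSeparates δ P′ w u v z → LineSeparates δ P w′ u′ v′ z′
  lineSeparates-transfers δ cw cu cv cz (u<w , w<v , w<z) =
    beyond-transfers δ cu cw u<w , beyond-transfers δ cw cv w<v , beyond-transfers δ cw cz w<z

another-below-2 : ∀ c → ∃ λ z → z < 2 × z ≢ c
another-below-2 zero    = 1 , ≤-refl , λ ()
another-below-2 (suc c) = 0 , z<s , λ ()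

module SameColumns {k} (π : Permutation′ (suc k)) (simple : Simple π)
                     (P : Seq) (σ : Permutation′ (suc k)) (iso : OrderIsoVia P π σ) (pins : PinSequence P (suc k))
                     (P′ : Seq) (σ′ : Permutation′ (suc k)) (iso′ : OrderIsoVia P′ π σ′) (pins′ : PinSequence P′ (suc k))
                     (same-orientation : orientation P ≡ orientation P′)
                     (δ : Direction) (last : Extreme δ P k) (last′ : Extreme δ P′ k) where
  open RankComparison π P σ iso P′ σ′ iso′
  module Swap = RankComparison π P′ σ′ iso′ P σ iso
  module RepA = PinRepOfSimple π simple P σ iso pins
  module RepB = PinRepOfSimple π simple P′ σ′ iso′ pins′

  swap-agreement : ∀ {m} → AgreeFrom m → Swap.AgreeFrom m
  swap-agreement agree j m≤j j<N = sym (agree j m≤j j<N)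

  nothing-above : AgreeFrom (suc k)
  nothing-above j k<j j<N = ⊥-elim (<⇒≱ j<N k<j)

  last-mismatch-impossible : A.col k ≢ B.col k → ⊥
  last-mismatch-impossible mismatch =
    let b , b<k , eb = moved-before ≤-refl ≤-refl nothing-above (mismatch ∘ sym)
        c , c<k , ec = Swap.moved-before ≤-refl ≤-refl (swap-agreement nothing-above) mismatch
    in beyond-asym δ (last c c<k)
         (beyond-transfers δ (<-trans b<k ≤-refl , ≤-refl , eb) (≤-refl , <-trans c<k ≤-refl , sym ec) (last′ b b<k))

  -- Were P m and P′ m in different cells, P (m+1) would separate P m from an earlier point c, and
  -- (read through P′) c from P m; z ∈ {0, 1} rules out that both separations use the same line.
  mismatch-impossible : ∀ {m} → 2 ≤ m → suc m < suc k → AgreeFrom (suc m) → A.col m ≢ B.col m → ⊥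
  mismatch-impossible {m} 2≤m sm<N agree mismatch =
    let b , b<m , eb     = moved-before m<N ≤-refl agree (mismatch ∘ sym)
        c , c<m , ec     = Swap.moved-before m<N ≤-refl (swap-agreement agree) mismatch
        z , z<2 , z≢c    = another-below-2 c
        z<m              = <-≤-trans z<2 2≤m
        bz , bz<m , ebz  = moved-before m<N (<⇒≤ z<m) agree
                             (λ e → z≢c (A.col-injective (below z<m) (below c<m) (trans (sym e) (sym ec))))
        δA , separationA = sepCond⇒separation (RepA.late-separation (m≤n⇒m≤1+n 2≤m) sm<N)
        δB , separationB = sepCond⇒separation (RepB.late-separation (m≤n⇒m≤1+n 2≤m) sm<N)
    in crossed-separations δA δB ≤-refl (m<n⇒m<1+n c<m) (proj₁ (proj₂ pins (suc m) z<s sm<N))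
         (separation⇒lineSeparates δA separationA c<m z<m)
         (lineSeparates-transfers δB (sm<N , sm<N , sym (agree (suc m) ≤-refl sm<N)) (m<N , below c<m , sym ec)
            (below b<m , m<N , eb) (below bz<m , below z<m , ebz)
            (separation⇒lineSeparates δB separationB b<m bz<m))
    where
    m<N : m < suc k
    m<N = <-trans ≤-refl sm<N
    below : ∀ {i} → i < m → i < suc k
    below i<m = <-trans i<m m<N

  extend : ∀ {m} → A.col m ≡ B.col m → AgreeFrom (suc m) → AgreeFrom m
  extend eq agree j m≤j j<N with m≤n⇒m<n∨m≡n m≤j
  ... | inj₁ m<j  = agree j m<j j<N
  ... | inj₂ refl = eq

  agrees-at : ∀ {m} → 2 ≤ m → m < suc k → AgreeFrom (suc m) → A.col m ≡ B.col m
  agrees-at {m} 2≤m m<N agree with A.col m ≟ B.col m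
  ... | yes eq      = eq
  ... | no mismatch with m≤n⇒m<n∨m≡n (s≤s⁻¹ m<N)
  ...   | inj₂ refl = ⊥-elim (last-mismatch-impossible mismatch)
  ...   | inj₁ m<k  = ⊥-elim (mismatch-impossible 2≤m (s≤s m<k) agree mismatch)

  agree-from : ∀ t {m} → 2 ≤ m → t + m ≡ suc k → AgreeFrom m
  agree-from zero    _   refl j m≤j j<N = ⊥-elim (<⇒≱ j<N m≤j)
  agree-from (suc t) {m} 2≤m eq = extend (agrees-at 2≤m (subst (m <_) eq (m<n+m m z<s)) above) above
    where
    above = agree-from t (m≤n⇒m≤1+n 2≤m) (trans (+-suc t m) eq)

  2≤N : 2 ≤ suc k
  2≤N = m≤n⇒m≤1+n (simple⇒2≤k π simple)

  agree-from-2 : AgreeFrom 2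
  agree-from-2 = agree-from (suc k ∸ 2) ≤-refl (m∸n+n≡m 2≤N)

  taken-before-2 : ∀ {i} → i < 2 → ∃ λ a → a < 2 × A.col a ≡ B.col i
  taken-before-2 {i} i<2 = A.col-taken-before 2 (B.col<N i) λ j 2≤j j<N eq →
    <-irrefl (B.col-injective (<-≤-trans i<2 2≤N) j<N (trans (sym eq) (agree-from-2 j 2≤j j<N)))
             (<-≤-trans i<2 2≤j)

  unswapped : A.col 1 ≡ B.col 0 → A.col 0 ≡ B.col 1 → ⊥
  unswapped e1 e0 with <-cmp (X (P 0)) (X (P 1))
  ... | tri< lt _ _ = swap-breaks-orientation 2≤N same-orientation (sym e1) (sym e0) lt
  ... | tri≈ _ eq _ = proj₁ (proj₁ pins 0 1 z<s 2≤N (λ ())) eq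
  ... | tri> _ _ gt = Swap.swap-breaks-orientation 2≤N (sym same-orientation) e0 e1
                        (Swap.same-cell-preserves (2≤N , z<s , e1) (z<s , 2≤N , e0) horizontal gt)

  first-two-agree : A.col 0 ≡ B.col 0 × A.col 1 ≡ B.col 1
  first-two-agree with taken-before-2 {0} z<s | taken-before-2 {1} ≤-refl
  ... | 0 , _ , e0 | 1 , _ , e1 = e0 , e1
  ... | 1 , _ , e1 | 0 , _ , e0 = ⊥-elim (unswapped e1 e0)
  ... | 0 , _ , e0 | 0 , _ , e0′ = ⊥-elim (0≢1+n (B.col-injective z<s 2≤N (trans (sym e0) e0′)))
  ... | 1 , _ , e1′ | 1 , _ , e1 = ⊥-elim (0≢1+n (B.col-injective z<s 2≤N (trans (sym e1′) e1)))
  ... | suc (suc _) , s≤s (s≤s ()) , _ | _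
  ... | _ | suc (suc _) , s≤s (s≤s ()) , _

  cols-agree : ∀ j → j < suc k → A.col j ≡ B.col j
  cols-agree 0             _   = proj₁ first-two-agree
  cols-agree 1             _   = proj₂ first-two-agree
  cols-agree (suc (suc j)) j<N = agree-from-2 (suc (suc j)) (s≤s (s≤s z≤n)) j<N

  order-transfers : ∀ {a b} → a < suc k → b < suc k → OrderPreserved (P′ a) (P′ b) (P a) (P b)
  order-transfers a<N b<N = same-cell-preserves (a<N , a<N , sym (cols-agree _ a<N)) (b<N , b<N , sym (cols-agree _ b<N))

-- Two pin words of the same permutation

-- After a direction, the side of the first numeral across that direction's axis is forced by
-- the separation, so only its side along the axis is recorded.
openingCode : Letter → Letter → (Bool × Bool) ⊎ Bool
openingCode a b =
  [ (λ _ → inj₁ (corner a horizontal , corner a vertical)) , (λ _ → inj₂ (corner a (axis b))) ]′ (letter-kind b)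

-- indices of p₁ … pₙ after the origin, which two pin words need not share
PointIndex : ℕ → ℕ → Set
PointIndex k x = 0 < x × x ≤ suc k

module PinWordComparison {k} (π : Permutation′ (suc k)) (simple : Simple π)
  (P : Seq) (σ : Permutation′ (suc k)) (iso : OrderIsoVia P π σ) (pins : PinSequence P (suc k)) (p0 : Point)
  (P′ : Seq) (σ′ : Permutation′ (suc k)) (iso′ : OrderIsoVia P′ π σ′) (pins′ : PinSequence P′ (suc k)) (p0′ : Point)
  (transfer : ∀ {x y} → x < suc k → y < suc k → OrderPreserved (P′ x) (P′ y) (P x) (P y)) where

  module WA = WordOfPinRep π simple P σ iso pins p0
  module WB = WordOfPinRep π simple P′ σ′ iso′ pins′ p0′

  Q Q′ : Seq
  Q  = withOrigin p0 P
  Q′ = withOrigin p0′ P′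

  transferQ : Preserves Q′ Q (PointIndex k)
  transferQ {suc x} {suc y} (_ , s≤s x≤k) (_ , s≤s y≤k) = transfer (s≤s x≤k) (s≤s y≤k)

  letter-agrees : ∀ {i ℓ ℓ′} → 2 ≤ i → i < suc k → Encodes Q (suc i) ℓ → Encodes Q′ (suc i) ℓ′ → ℓ ≡ ℓ′
  letter-agrees {i} {ℓ} {ℓ′} 2≤i i<N e e′ = direction-injective d d′
    (profile-unique (direction ℓ) (direction ℓ′) {Q} {suc i} {i} {1} (direction-profile {Q} d e 1<i)
      (profile-preserved (direction ℓ′) {Q′} {Q} {PointIndex k} {suc i} {i} {1} transferQ
        (z<s , i<N) (<-trans z<s 1<i , <⇒≤ i<N) (z<s , s≤s z≤n) (direction-profile {Q′} d′ e′ 1<i)))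
    where
    1<i = 2≤i
    d  = WA.late-letter-direction 2≤i i<N e
    d′ = WB.late-letter-direction 2≤i i<N e′

  later-letters-agree : ∀ {i} ws ws′ → 2 ≤ i → i + length ws ≡ suc k → length ws ≡ length ws′ →
    EncodesFrom Q (suc i) ws → EncodesFrom Q′ (suc i) ws′ → ws ≡ ws′
  later-letters-agree []       []         _   _   _   _        _          = refl
  later-letters-agree {i} (ℓ ∷ ws) (ℓ′ ∷ ws′) 2≤i len len′ (e , es) (e′ , es′) =
    cong₂ _∷_ (letter-agrees 2≤i (subst (i <_) len (m<m+n i z<s)) e e′)
      (later-letters-agree ws ws′ (m≤n⇒m≤1+n 2≤i) (trans (sym (+-suc i (length ws))) len) (suc-injective len′) es es′)

  2≤N : 2 ≤ suc k
  2≤N = m≤n⇒m≤1+n (simple⇒2≤k π simple)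

  transfer-1-2 : ∀ δ → Beyond δ (Q′ 1) (Q′ 2) → Beyond δ (Q 1) (Q 2)
  transfer-1-2 δ = beyond-preserves δ {Q′} {Q} {PointIndex k} {1} {2} transferQ (z<s , s≤s z≤n) (z<s , 2≤N)

  second-numeral-agrees : ∀ {b b′} → IsNumeral b → IsNumeral b′ → Encodes Q 2 b → Encodes Q′ 2 b′ → b ≡ b′
  second-numeral-agrees {b} {b′} nb nb′ eb eb′ = numeral-injective nb nb′ λ ax →
    <⟨⟩-sense-unique (corner b ax) (corner b′ ax) (proj₂ (encodes-numeral nb eb) ax 1 ≤-refl)
      (transfer-1-2 (ax , corner b′ ax) (proj₂ (encodes-numeral nb′ eb′) ax 1 ≤-refl))

  second-direction-agrees : ∀ {b b′ c} → IsDirection b → IsDirection b′ →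
    Encodes Q 2 b → Encodes Q′ 2 b′ → Encodes Q 3 c → Encodes Q′ 3 c → b ≡ b′
  second-direction-agrees {b} {b′} db db′ eb eb′ ec ec′ = direction-injective db db′ (cong₂ _,_ same-axis same-sense)
    where
    dc = WA.late-letter-direction ≤-refl (s≤s (simple⇒2≤k π simple)) ec
    same-axis : axis b ≡ axis b′
    same-axis = trans (second-axis db dc eb ec) (sym (second-axis db′ dc eb′ ec′))
    same-sense : sense b ≡ sense b′
    same-sense = <⟨⟩-sense-unique (sense b) (sense b′) (proj₁ (direction-separation db eb) 1 ≤-refl)
      (subst (λ ax → Beyond (ax , sense b′) (Q 1) (Q 2)) (sym same-axis)
        (transfer-1-2 (direction b′) (proj₁ (direction-separation db′ eb′) 1 ≤-refl)))

  first-numeral-agrees : ∀ {a a′ b} → IsDirection b → Encodes Q 1 a → Encodes Q′ 1 a′ →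
    Encodes Q 2 b → Encodes Q′ 2 b → corner a (axis b) ≡ corner a′ (axis b) → a ≡ a′
  first-numeral-agrees {a} {a′} {b} db ea ea′ eb eb′ same =
    numeral-injective (first-letter-numeral ea) (first-letter-numeral ea′) corners
    where
    s  = proj₁ (proj₂ (direction-separation db eb))
    s′ = proj₁ (proj₂ (direction-separation db eb′))
    separation  = proj₂ (proj₂ (direction-separation db eb))
    separation′ = proj₂ (proj₂ (direction-separation db eb′))
    s≡s′ : s ≡ s′
    s≡s′ = <⟨⟩-sense-unique s s′ (proj₁ separation) (transfer-1-2 (perp (axis b) , s′) (proj₁ separation′))
    corners : ∀ ax → corner a ax ≡ corner a′ ax
    corners ax with axis-dichotomy (axis b) ax
    ... | inj₁ refl = same
    ... | inj₂ refl = begin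
      corner a (perp (axis b))   ≡⟨ numeral-side (perp (axis b)) s (first-letter-numeral ea) ea separation ⟩
      not s                      ≡⟨ cong not s≡s′ ⟩
      not s′                     ≡⟨ numeral-side (perp (axis b)) s′ (first-letter-numeral ea′) ea′ separation′ ⟨
      corner a′ (perp (axis b))  ∎
      where open ≡-Reasoning

  opening-agrees : ∀ {a b a′ b′ c} → Encodes Q 1 a → Encodes Q 2 b → Encodes Q′ 1 a′ → Encodes Q′ 2 b′ →
    Encodes Q 3 c → Encodes Q′ 3 c → openingCode a b ≡ openingCode a′ b′ → a ≡ a′ × b ≡ b′
  opening-agrees {b = b} {b′ = b′} ea eb ea′ eb′ ec ec′ same with letter-kind b | letter-kind b′
  ... | inj₁ nb | inj₁ nb′ =
    numeral-injective (first-letter-numeral ea) (first-letter-numeral ea′)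
      (λ { horizontal → cong proj₁ (inj₁-injective same) ; vertical → cong proj₂ (inj₁-injective same) }) ,
    second-numeral-agrees nb nb′ eb eb′
  opening-agrees ea eb ea′ eb′ ec ec′ () | inj₁ _ | inj₂ _
  opening-agrees ea eb ea′ eb′ ec ec′ () | inj₂ _ | inj₁ _
  ... | inj₂ db | inj₂ db′ with second-direction-agrees db db′ eb eb′ ec ec′
  ...   | refl = first-numeral-agrees db ea ea′ eb eb′ (inj₂-injective same) , refl

-- Counting pin words

Code : Set
Code = Bool × Direction × ((Bool × Bool) ⊎ Bool)

wordCode : Seq → List Letter → Code
wordCode P (a ∷ b ∷ w) = orientation P , direction (finalLetter b w) , openingCode a b
-- junk: pin words of simple permutations have at least four letters
wordCode P _           = orientation P , (horizontal , true) , inj₂ true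

pinWordCode : ∀ {n} (π : Permutation′ n) {w} → IsPinWord π w → Code
pinWordCode _ {w} (P , _) = wordCode P w

bit : Bool → Fin 2
bit false = zero
bit true  = suc zero

bit-injective : ∀ {s t} → bit s ≡ bit t → s ≡ t
bit-injective {false} {false} _ = refl
bit-injective {true}  {true}  _ = refl

axisBit : Axis → Fin 2
axisBit horizontal = zero
axisBit vertical   = suc zero

axisBit-injective : ∀ {ax ax′} → axisBit ax ≡ axisBit ax′ → ax ≡ ax′
axisBit-injective {horizontal} {horizontal} _ = refl
axisBit-injective {vertical}   {vertical}   _ = refl

openingIndex : (Bool × Bool) ⊎ Bool → Fin 6
openingIndex (inj₁ (s , t)) = join 4 2 (inj₁ (combine (bit s) (bit t)))
openingIndex (inj₂ s)       = join 4 2 (inj₂ (bit s))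

openingIndex-injective : ∀ o o′ → openingIndex o ≡ openingIndex o′ → o ≡ o′
openingIndex-injective (inj₁ (s , t)) (inj₁ (s′ , t′)) eq
  with combine-injective (bit s) (bit t) (bit s′) (bit t′) (inj₁-injective (join-injective 4 2 _ _ eq))
... | s≡ , t≡ = cong₂ (λ x y → inj₁ (x , y)) (bit-injective s≡) (bit-injective t≡)
openingIndex-injective (inj₂ s) (inj₂ s′) eq = cong inj₂ (bit-injective (inj₂-injective (join-injective 4 2 _ _ eq)))
openingIndex-injective (inj₁ (s , t)) (inj₂ s′) eq
  with () ← join-injective 4 2 (inj₁ (combine (bit s) (bit t))) (inj₂ (bit s′)) eq
openingIndex-injective (inj₂ s) (inj₁ (s′ , t′)) eq
  with () ← join-injective 4 2 (inj₂ (bit s)) (inj₁ (combine (bit s′) (bit t′))) eq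

encode : Code → Fin 48
encode (o , (ax , s) , h) = combine (bit o) (combine (combine (axisBit ax) (bit s)) (openingIndex h))

encode-injective : ∀ {c c′} → encode c ≡ encode c′ → c ≡ c′
encode-injective {o , (ax , s) , h} {o′ , (ax′ , s′) , h′} eq
  with combine-injective _ _ _ _ eq
... | o≡ , rest with combine-injective _ _ _ _ rest
...   | d≡ , h≡ with combine-injective _ _ _ _ d≡
...     | ax≡ , s≡ = cong₂ _,_ (bit-injective o≡)
                       (cong₂ _,_ (cong₂ _,_ (axisBit-injective ax≡) (bit-injective s≡)) (openingIndex-injective h h′ h≡))

module SimplePinWords {k} (π : Permutation′ (suc k)) (simple : Simple π) where

  pinWordCode-injective : ∀ {w w′} (W : IsPinWord π w) (W′ : IsPinWord π w′) →
    pinWordCode π W ≡ pinWordCode π W′ → w ≡ w′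
  pinWordCode-injective {a ∷ b ∷ c ∷ rest} {a′ ∷ b′ ∷ c′ ∷ rest′}
    (P  , p0  , ((σ  , iso)  , pins)  , _ , len  , ea  , eb  , ec  , er)
    (P′ , p0′ , ((σ′ , iso′) , pins′) , _ , len′ , ea′ , eb′ , ec′ , er′) same =
    cong₂ _∷_ (proj₁ opening) (cong₂ _∷_ (proj₂ opening) later≡)
    where
    module WA = WordOfPinRep π simple P σ iso pins p0
    module WB = WordOfPinRep π simple P′ σ′ iso′ pins′ p0′
    final  = WA.final-letter-direction
               (subst (λ j → Encodes (withOrigin p0 P) j (finalLetter c rest)) len (encodes-final b (c ∷ rest) (eb , ec , er)))
    final′ = WB.final-letter-direction
               (subst (λ j → Encodes (withOrigin p0′ P′) j (finalLetter c′ rest′)) len′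
                 (encodes-final b′ (c′ ∷ rest′) (eb′ , ec′ , er′)))
    same-final : direction (finalLetter c′ rest′) ≡ direction (finalLetter c rest)
    same-final = cong (λ (code : Code) → proj₁ (proj₂ code)) (sym same)
    same-orientation : orientation P ≡ orientation P′
    same-orientation = cong (λ (code : Code) → proj₁ code) same
    open SameColumns π simple P σ iso pins P′ σ′ iso′ pins′ same-orientation
           (direction (finalLetter c rest)) (proj₂ final)
           (subst (λ δ → Extreme δ P′ k) same-final (proj₂ final′)) using (order-transfers)
    open PinWordComparison π simple P σ iso pins p0 P′ σ′ iso′ pins′ p0′ order-transfers
    later≡ : c ∷ rest ≡ c′ ∷ rest′
    later≡ = later-letters-agree (c ∷ rest) (c′ ∷ rest′) ≤-refl len (suc-injective (suc-injective (trans len (sym len′))))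
               (ec , er) (ec′ , er′)
    opening = opening-agrees ea eb ea′ eb′ ec (subst (Encodes Q′ 3) (sym (proj₁ (∷-injective later≡))) ec′)
                (cong (λ (code : Code) → proj₂ (proj₂ code)) same)
  pinWordCode-injective {[]} (_ , _ , _ , _ , () , _) _ _
  pinWordCode-injective {_ ∷ []} (_ , _ , _ , _ , refl , _) _ _ with simple⇒2≤k π simple
  ... | ()
  pinWordCode-injective {_ ∷ _ ∷ []} (_ , _ , _ , _ , refl , _) _ _ with simple⇒2≤k π simple
  ... | s≤s ()
  pinWordCode-injective {_ ∷ _ ∷ _ ∷ _} {[]} _ (_ , _ , _ , _ , () , _) _
  pinWordCode-injective {_ ∷ _ ∷ _ ∷ _} {_ ∷ []} _ (_ , _ , _ , _ , refl , _) _ with simple⇒2≤k π simple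
  ... | ()
  pinWordCode-injective {_ ∷ _ ∷ _ ∷ _} {_ ∷ _ ∷ []} _ (_ , _ , _ , _ , refl , _) _ with simple⇒2≤k π simple
  ... | s≤s ()

  pinWord-strict-or-quasiStrict : ∀ w → IsPinWord π w → Strict w ⊎ QuasiStrict w
  pinWord-strict-or-quasiStrict w (P , p0 , ((σ , iso) , pins) , _ , len , enc) =
    WordOfPinRep.pinWord-shape π simple P σ iso pins p0 w len enc

theoremB8 : ∀ (n : ℕ) (π : Permutation′ n) → Simple π →
    (∀ (ws : List (List Letter)) → Unique ws → All (IsPinWord π) ws → length ws ≤ 48)
    × (∀ (w : List Letter) → IsPinWord π w → Strict w ⊎ QuasiStrict w)
theoremB8 zero    π (() , _)
theoremB8 (suc k) π simple =
  (λ ws unique all → length-≤-injection (encode ∘ pinWordCode π)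
                       (λ W W′ eq → pinWordCode-injective W W′ (encode-injective eq)) unique all) ,
  pinWord-strict-or-quasiStrict
  where open SimplePinWords π simple
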